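{- Let $G$ be a finite simple graph with vertex set $V(G)=\{v_1,\ldots,v_n\}$, and let $A\subseteq V(G)$ be arbitrary. Let $M_G$ be the adjacency matrix of $G$ and let $D_A$ be the diagonal matrix with $d_{ii}=1$ if and only if $v_i\in A$ (and $d_{ii}=0$ otherwise), both regarded as matrices over $GF(2)$. Let $\tilde G_A$ be the looped graph obtained from $G$ by placing a loop at each vertex of $A$. Then the following are equivalent: (a) $G$ satisfies property $P(A)$. (b) $\tilde G_A$ is an orthoprojection graph. (c) $M_G+D_A$ is idempotent over $GF(2)$.
   Context: $G$ satisfies property $P(A)$ if $G$ is eulerian (every vertex has even degree) and, for each pair of distinct vertices $u,v$ of $G$, $u$ and $v$ have an odd number of common neighbors if and only if $u$ and $v$ are adjacent and either both are in $A$ or neither is in $A$. A finite looped graph (no multiple loops or multiple edges) is an orthoprojection graph if for every pair of (not necessarily distinct) vertices $u,v$, $u$ and $v$ have an odd number of common neighbors iff $u$ and $v$ are neighbors, where a vertex is a neighbor of itself iff it is looped. -}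

module Defs where

open import Data.Nat using (ℕ; zero; suc; _+_; _%_)
open import Data.Bool using (Bool; true; false; _∧_; _∨_; _xor_; if_then_else_)
open import Data.Fin using (Fin; zero; suc)
open import Data.Product using (_×_)
open import Relation.Nullary using (¬_)
open import Relation.Binary.PropositionalEquality using (_≡_)
open import Function.Bundles using (_⇔_)

count : ∀ {n} → (Fin n → Bool) → ℕ
count {zero}  f = 0
count {suc n} f = (if f zero then 1 else 0) + count (λ i → f (suc i))

Even Odd : ℕ → Set
Even k = k % 2 ≡ 0
Odd  k = k % 2 ≡ 1

_==_ : ∀ {n} → Fin n → Fin n → Bool
zero  == zero  = true
zero  == suc _ = false
suc _ == zero  = false
suc i == suc j = i == j

record SimpleGraph (n : ℕ) : Set where
  field
    adj   : Fin n → Fin n → Bool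
    sym   : ∀ u v → adj u v ≡ adj v u
    loopless : ∀ v → adj v v ≡ false
open SimpleGraph public

VSubset : ℕ → Set
VSubset n = Fin n → Bool

-- A finite looped graph (at most one loop per vertex, no multiple edges):
-- a symmetric adjacency relation; adj v v = true means v is looped.
record LoopedGraph (n : ℕ) : Set where
  field
    ladj  : Fin n → Fin n → Bool
    lsym  : ∀ u v → ladj u v ≡ ladj v u
open LoopedGraph public

degree : ∀ {n} → SimpleGraph n → Fin n → ℕ
degree G v = count (λ w → adj G v w)

commonNbrs : ∀ {n} → SimpleGraph n → Fin n → Fin n → ℕ
commonNbrs G u v = count (λ w → adj G u w ∧ adj G v w)

Eulerian : ∀ {n} → SimpleGraph n → Set
Eulerian G = ∀ v → Even (degree G v)

P : ∀ {n} → SimpleGraph n → VSubset n → Set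
P G A = Eulerian G ×
  (∀ u v → ¬ (u ≡ v) →
     (Odd (commonNbrs G u v) ⇔ (adj G u v ≡ true × A u ≡ A v)))

-- Common neighbours in a looped graph (a vertex is its own neighbour iff looped).
lcommonNbrs : ∀ {n} → LoopedGraph n → Fin n → Fin n → ℕ
lcommonNbrs L u v = count (λ w → ladj L u w ∧ ladj L v w)

Orthoprojection : ∀ {n} → LoopedGraph n → Set
Orthoprojection L = ∀ u v → (Odd (lcommonNbrs L u v) ⇔ ladj L u v ≡ true)

addLoops : ∀ {n} → SimpleGraph n → VSubset n → LoopedGraph n
addLoops G A = record
  { ladj = λ u v → adj G u v ∨ ((u == v) ∧ A u)
  ; lsym = λ u v → symproof u v }
  where
  open import Relation.Binary.PropositionalEquality using (refl; cong; cong₂)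
  ==-sym : ∀ {m} (u v : Fin m) → (u == v) ≡ (v == u)
  ==-sym zero zero = refl
  ==-sym zero (suc v) = refl
  ==-sym (suc u) zero = refl
  ==-sym (suc u) (suc v) = ==-sym u v
  ==-eq : ∀ {m} (u v : Fin m) → (u == v) ≡ true → u ≡ v
  ==-eq zero zero _ = refl
  ==-eq zero (suc v) ()
  ==-eq (suc u) zero ()
  ==-eq (suc u) (suc v) p = cong suc (==-eq u v p)
  ==-refl : ∀ {m} (u : Fin m) → (u == u) ≡ true
  ==-refl zero = refl
  ==-refl (suc u) = ==-refl u
  aux : ∀ u v (b : Bool) → (u == v) ≡ b →
        (adj G u v ∨ ((u == v) ∧ A u)) ≡ (adj G v u ∨ ((v == u) ∧ A v))
  aux u v false eq rewrite ==-sym v u | eq = cong₂ _∨_ (sym G u v) refl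
  aux u v true eq with ==-eq u v eq
  ... | refl = refl
  symproof : ∀ u v → (adj G u v ∨ ((u == v) ∧ A u)) ≡ (adj G v u ∨ ((v == u) ∧ A v))
  symproof u v = aux u v (u == v) refl

-- Matrices over GF(2), with GF(2) = Bool (xor = +, ∧ = ·).
Matrix2 : ℕ → Set
Matrix2 n = Fin n → Fin n → Bool

Σ2 : ∀ {n} → (Fin n → Bool) → Bool
Σ2 {zero}  f = false
Σ2 {suc n} f = f zero xor Σ2 (λ i → f (suc i))

_+M_ : ∀ {n} → Matrix2 n → Matrix2 n → Matrix2 n
(M +M N) i j = M i j xor N i j

_*M_ : ∀ {n} → Matrix2 n → Matrix2 n → Matrix2 n
(M *M N) i j = Σ2 (λ k → M i k ∧ N k j)

Idempotent : ∀ {n} → Matrix2 n → Set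
Idempotent M = ∀ i j → (M *M M) i j ≡ M i j

adjMatrix : ∀ {n} → SimpleGraph n → Matrix2 n
adjMatrix G i j = adj G i j

diagMatrix : ∀ {n} → VSubset n → Matrix2 n
diagMatrix A i j = (i == j) ∧ A i

module Submission where

-- Read Booleans as GF(2): counting modulo 2 is the GF(2)
-- sum Σ2, so "u and v have an odd number of common neighbours" says
-- that the (u,v) entry of the square of the adjacency matrix is 1.
--
--  * For any looped graph L (symmetric adjacency), L is an
--    orthoprojection graph iff its adjacency matrix is idempotent.
--    Since the adjacency matrix of G̃_A is M_G + D_A, this gives (b) ⇔ (c).
--  * Expanding (M_G + D_A)² = M_G² + M_G D_A + D_A M_G + D_A over GF(2)
--    shows that M_G + D_A is idempotent iff every entry satisfies
--    (M_G²)(u,v) = [u ~ v] · [u ∈ A ⇔ v ∈ A]  (the "parity condition").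
--  * Property P(A) is exactly the parity condition: on the diagonal it
--    says that degrees are even (G is loopless), off the diagonal it is
--    the common-neighbour clause of P(A).  This gives (a) ⇔ (c).

open import Defs renaming (sym to adj-sym)
open import Data.Nat using (ℕ; zero; suc; _%_)
open import Data.Bool using (Bool; true; false; _∧_; _xor_; not; if_then_else_)
open import Data.Bool.Properties using (xor-∧-commutativeRing; ∧-distribˡ-xor; ∧-distribʳ-xor; ∧-assoc; ∧-idem; ∧-zeroʳ; ∨-identityʳ; xor-identityʳ)
open import Data.Bool.Solver using (module xor-∧-Solver)
open import Data.Fin using (Fin; zero; suc)
open import Data.Fin.Properties using (_≟_)
open import Data.Product using (_×_; _,_)
open import Algebra.Bundles using (CommutativeRing)
open import Algebra.Properties.CommutativeSemigroup (CommutativeRing.+-commutativeSemigroup xor-∧-commutativeRing) using (interchange)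
open import Function.Bundles using (_⇔_; mk⇔; Equivalence)
open import Function.Construct.Composition using (_⇔-∘_)
open import Function.Construct.Symmetry using (⇔-sym)
open import Relation.Nullary using (¬_; yes; no)
open import Relation.Binary.PropositionalEquality
open xor-∧-Solver using (solve; con; _:+_; _:*_; _:=_)
open Equivalence using (to; from)

bool-ext : ∀ {a b : Bool} → (a ≡ true ⇔ b ≡ true) → a ≡ b
bool-ext {false} {false} _ = refl
bool-ext {false} {true}  e = from e refl
bool-ext {true}  {false} e = sym (to e refl)
bool-ext {true}  {true}  _ = refl

≡-⇔ˡ : ∀ {a b c : Bool} → a ≡ b → (a ≡ c ⇔ b ≡ c)
≡-⇔ˡ a≡b = mk⇔ (trans (sym a≡b)) (trans a≡b)

xor≡false : ∀ x y → (x xor y ≡ false) ⇔ (x ≡ y)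
xor≡false false false = mk⇔ (λ _ → refl) (λ _ → refl)
xor≡false false true  = mk⇔ (λ ()) (λ ())
xor≡false true  false = mk⇔ (λ ()) (λ ())
xor≡false true  true  = mk⇔ (λ _ → refl) (λ _ → refl)

∧-not-xor≡true : ∀ a x y → (a ∧ not (x xor y) ≡ true) ⇔ (a ≡ true × x ≡ y)
∧-not-xor≡true false x y = mk⇔ (λ ()) (λ { (() , _) })
∧-not-xor≡true true  x y =
  mk⇔ (λ e → refl , to (xor≡false x y) (not-true e))
      (λ { (_ , x≡y) → cong not (from (xor≡false x y) x≡y) })
  where
  not-true : ∀ {b} → not b ≡ true → b ≡ false
  not-true {false} _ = refl

bitValue : Bool → ℕ
bitValue b = if b then 1 else 0

bitValue-injective : ∀ {a b} → bitValue a ≡ bitValue b → a ≡ b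
bitValue-injective {false} {false} _ = refl
bitValue-injective {true}  {true}  _ = refl

suc-flips-parity : ∀ k b → k % 2 ≡ bitValue b → suc k % 2 ≡ bitValue (not b)
suc-flips-parity zero          false _ = refl
suc-flips-parity (suc zero)    true  _ = refl
suc-flips-parity (suc (suc k)) b     e = suc-flips-parity k b e

count-mod2 : ∀ {n} (f : Fin n → Bool) → count f % 2 ≡ bitValue (Σ2 f)
count-mod2 {zero}  f = refl
count-mod2 {suc n} f with f zero
... | false = count-mod2 (λ i → f (suc i))
... | true  = suc-flips-parity (count (λ i → f (suc i))) (Σ2 (λ i → f (suc i))) (count-mod2 (λ i → f (suc i)))

count-parity : ∀ {n} (f : Fin n → Bool) b → (count f % 2 ≡ bitValue b) ⇔ (Σ2 f ≡ b)
count-parity f b =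
  mk⇔ (λ e → bitValue-injective (trans (sym (count-mod2 f)) e))
      (λ e → trans (count-mod2 f) (cong bitValue e))

Σ2-cong : ∀ {n} {f g : Fin n → Bool} → (∀ w → f w ≡ g w) → Σ2 f ≡ Σ2 g
Σ2-cong {zero}  f≗g = refl
Σ2-cong {suc n} f≗g = cong₂ _xor_ (f≗g zero) (Σ2-cong (λ i → f≗g (suc i)))

Σ2-xor : ∀ {n} (f g : Fin n → Bool) → Σ2 (λ w → f w xor g w) ≡ Σ2 f xor Σ2 g
Σ2-xor {zero}  f g = refl
Σ2-xor {suc n} f g = begin
  (f zero xor g zero) xor Σ2 (λ i → f (suc i) xor g (suc i))
    ≡⟨ cong ((f zero xor g zero) xor_) (Σ2-xor (λ i → f (suc i)) (λ i → g (suc i))) ⟩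
  (f zero xor g zero) xor (Σ2 (λ i → f (suc i)) xor Σ2 (λ i → g (suc i)))
    ≡⟨ interchange (f zero) (g zero) _ _ ⟩
  Σ2 f xor Σ2 g ∎
  where open ≡-Reasoning

Σ2-false : ∀ {n} → Σ2 {n} (λ _ → false) ≡ false
Σ2-false {zero}  = refl
Σ2-false {suc n} = Σ2-false {n}

Σ2-delta : ∀ {n} (u : Fin n) (g : Fin n → Bool) → Σ2 (λ w → (u == w) ∧ g w) ≡ g u
Σ2-delta {suc n} zero    g = trans (cong (g zero xor_) (Σ2-false {n})) (xor-identityʳ (g zero))
Σ2-delta {suc n} (suc u) g = Σ2-delta u (λ i → g (suc i))

==-sym : ∀ {n} (u v : Fin n) → (u == v) ≡ (v == u)
==-sym zero    zero    = refl
==-sym zero    (suc v) = refl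
==-sym (suc u) zero    = refl
==-sym (suc u) (suc v) = ==-sym u v

==-sound : ∀ {n} {u v : Fin n} → (u == v) ≡ true → u ≡ v
==-sound {u = zero}  {zero}  _ = refl
==-sound {u = suc u} {suc v} e = cong suc (==-sound e)

_≐_ : ∀ {n} → Matrix2 n → Matrix2 n → Set
M ≐ N = ∀ i j → M i j ≡ N i j

*M-distribʳ : ∀ {n} (X Y Z : Matrix2 n) → ((X +M Y) *M Z) ≐ ((X *M Z) +M (Y *M Z))
*M-distribʳ X Y Z i j =
  trans (Σ2-cong (λ k → ∧-distribʳ-xor (Z k j) (X i k) (Y i k)))
        (Σ2-xor (λ k → X i k ∧ Z k j) (λ k → Y i k ∧ Z k j))

*M-distribˡ : ∀ {n} (X Y Z : Matrix2 n) → (X *M (Y +M Z)) ≐ ((X *M Y) +M (X *M Z))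
*M-distribˡ X Y Z i j =
  trans (Σ2-cong (λ k → ∧-distribˡ-xor (X i k) (Y k j) (Z k j)))
        (Σ2-xor (λ k → X i k ∧ Y k j) (λ k → X i k ∧ Z k j))

*M-diagʳ : ∀ {n} (X : Matrix2 n) (A : VSubset n) → (X *M diagMatrix A) ≐ (λ i j → X i j ∧ A j)
*M-diagʳ X A i j =
  trans (Σ2-cong (λ k → trans (cong (λ e → X i k ∧ (e ∧ A k)) (==-sym k j)) (swap (X i k) (j == k) (A k))))
        (Σ2-delta j (λ k → X i k ∧ A k))
  where
  swap : ∀ x e a → x ∧ (e ∧ a) ≡ e ∧ (x ∧ a)
  swap = solve 3 (λ x e a → x :* (e :* a) := e :* (x :* a)) refl

*M-diagˡ : ∀ {n} (A : VSubset n) (X : Matrix2 n) → (diagMatrix A *M X) ≐ (λ i j → A i ∧ X i j)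
*M-diagˡ A X i j =
  trans (Σ2-cong (λ k → ∧-assoc (i == k) (A i) (X k j))) (Σ2-delta i (λ k → A i ∧ X k j))

diag-idempotent : ∀ {n} (A : VSubset n) → (diagMatrix A *M diagMatrix A) ≐ diagMatrix A
diag-idempotent A i j = trans (*M-diagˡ A (diagMatrix A) i j) (absorb (A i) (i == j))
  where
  absorb : ∀ a e → a ∧ (e ∧ a) ≡ e ∧ a
  absorb false e = sym (∧-zeroʳ e)
  absorb true  e = refl

idempotent-resp : ∀ {n} {M N : Matrix2 n} → M ≐ N → Idempotent M → Idempotent N
idempotent-resp {M = M} {N} M≐N idem i j =
  trans (Σ2-cong (λ k → sym (cong₂ _∧_ (M≐N i k) (M≐N k j))))
        (trans (idem i j) (M≐N i j))

common-as-square : ∀ {n} (R : Matrix2 n) → (∀ u v → R u v ≡ R v u) → ∀ u v →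
  Σ2 (λ w → R u w ∧ R v w) ≡ (R *M R) u v
common-as-square R R-sym u v = Σ2-cong (λ w → cong (R u w ∧_) (R-sym v w))

odd-common-as-square : ∀ {n} (R : Matrix2 n) → (∀ u v → R u v ≡ R v u) → ∀ u v →
  Odd (count (λ w → R u w ∧ R v w)) ⇔ ((R *M R) u v ≡ true)
odd-common-as-square R R-sym u v =
  ≡-⇔ˡ (common-as-square R R-sym u v) ⇔-∘ count-parity (λ w → R u w ∧ R v w) true

orthoprojection⇔idempotent : ∀ {n} (L : LoopedGraph n) → Orthoprojection L ⇔ Idempotent (ladj L)
orthoprojection⇔idempotent L =
  mk⇔ (λ orth u v → bool-ext (orth u v ⇔-∘ ⇔-sym (parity u v)))
      (λ idem u v → ≡-⇔ˡ (idem u v) ⇔-∘ parity u v)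
  where
  parity : ∀ u v → Odd (lcommonNbrs L u v) ⇔ ((ladj L *M ladj L) u v ≡ true)
  parity = odd-common-as-square (ladj L) (lsym L)

-- Since G has no loops, the adjacency matrix of G̃_A is M_G + D_A.
addLoops-matrix : ∀ {n} (G : SimpleGraph n) (A : VSubset n) →
  ladj (addLoops G A) ≐ (adjMatrix G +M diagMatrix A)
addLoops-matrix G A u v with u == v in u==v
... | false = trans (∨-identityʳ (adj G u v)) (sym (xor-identityʳ (adj G u v)))
... | true with ==-sound {u = u} {v} u==v
...   | refl rewrite loopless G u = refl

ParityCondition : ∀ {n} → SimpleGraph n → VSubset n → Set
ParityCondition G A = ∀ u v →
  (adjMatrix G *M adjMatrix G) u v ≡ adj G u v ∧ not (A u xor A v)

module _ {n : ℕ} (G : SimpleGraph n) (A : VSubset n) where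

  private
    Gm M : Matrix2 n
    Gm = adjMatrix G
    M  = Gm +M diagMatrix A

  -- (M_G + D_A)² expanded; D_A is idempotent.
  square-expansion : ∀ u v → (M *M M) u v ≡
    ((Gm *M Gm) u v xor (adj G u v ∧ A v)) xor ((A u ∧ adj G u v) xor diagMatrix A u v)
  square-expansion u v = begin
    (M *M M) u v
      ≡⟨ *M-distribʳ Gm (diagMatrix A) M u v ⟩
    (Gm *M M) u v xor (diagMatrix A *M M) u v
      ≡⟨ cong₂ _xor_ (*M-distribˡ Gm Gm (diagMatrix A) u v) (*M-distribˡ (diagMatrix A) Gm (diagMatrix A) u v) ⟩
    ((Gm *M Gm) u v xor (Gm *M diagMatrix A) u v) xor ((diagMatrix A *M Gm) u v xor (diagMatrix A *M diagMatrix A) u v)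
      ≡⟨ cong₂ _xor_ (cong ((Gm *M Gm) u v xor_) (*M-diagʳ Gm A u v))
                     (cong₂ _xor_ (*M-diagˡ A Gm u v) (diag-idempotent A u v)) ⟩
    ((Gm *M Gm) u v xor (adj G u v ∧ A v)) xor ((A u ∧ adj G u v) xor diagMatrix A u v) ∎
    where open ≡-Reasoning

  -- M² + M over GF(2): the diagonal part D_A cancels.
  square-defect : ∀ u v →
    (M *M M) u v xor M u v ≡ (Gm *M Gm) u v xor (adj G u v ∧ not (A u xor A v))
  square-defect u v =
    trans (cong (_xor M u v) (square-expansion u v))
          (defect-identity ((Gm *M Gm) u v) (adj G u v) (A u) (A v) (diagMatrix A u v))
    where
    defect-identity : ∀ g a x y d →
      ((g xor (a ∧ y)) xor ((x ∧ a) xor d)) xor (a xor d) ≡ g xor (a ∧ not (x xor y))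
    defect-identity = solve 5 (λ g a x y d →
      ((g :+ (a :* y)) :+ ((x :* a) :+ d)) :+ (a :+ d) := g :+ (a :* (con true :+ (x :+ y)))) refl

  idempotent⇔parityCondition : Idempotent M ⇔ ParityCondition G A
  idempotent⇔parityCondition =
    mk⇔ (λ idem u v → to (entry u v) (idem u v)) (λ cond u v → from (entry u v) (cond u v))
    where
    entry : ∀ u v → ((M *M M) u v ≡ M u v) ⇔ ((Gm *M Gm) u v ≡ adj G u v ∧ not (A u xor A v))
    entry u v = xor≡false _ _ ⇔-∘ (≡-⇔ˡ (square-defect u v) ⇔-∘ ⇔-sym (xor≡false _ _))

  degree-parity : ∀ v → Even (degree G v) ⇔ ((Gm *M Gm) v v ≡ false)
  degree-parity v =
    ≡-⇔ˡ (trans (Σ2-cong (λ w → sym (∧-idem (adj G v w)))) (common-as-square Gm (adj-sym G) v v))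
      ⇔-∘ count-parity (adj G v) false

  common-parity : ∀ u v → Odd (commonNbrs G u v) ⇔ ((Gm *M Gm) u v ≡ true)
  common-parity = odd-common-as-square Gm (adj-sym G)

  -- P(A) is the parity condition (the diagonal uses that G is loopless).
  P⇔parityCondition : P G A ⇔ ParityCondition G A
  P⇔parityCondition = mk⇔ toCondition fromCondition
    where
    toCondition : P G A → ParityCondition G A
    toCondition (eulerian , common) u v with u ≟ v
    ... | yes refl = trans (to (degree-parity u) (eulerian u))
                           (sym (cong (_∧ not (A u xor A u)) (loopless G u)))
    ... | no u≢v = bool-ext (⇔-sym (∧-not-xor≡true (adj G u v) (A u) (A v))
                              ⇔-∘ (common u v u≢v ⇔-∘ ⇔-sym (common-parity u v)))

    fromCondition : ParityCondition G A → P G A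
    fromCondition cond = eulerian , common
      where
      eulerian : Eulerian G
      eulerian v = from (degree-parity v) (trans (cond v v) (cong (_∧ not (A v xor A v)) (loopless G v)))
      common : ∀ u v → ¬ (u ≡ v) → Odd (commonNbrs G u v) ⇔ (adj G u v ≡ true × A u ≡ A v)
      common u v _ = ∧-not-xor≡true (adj G u v) (A u) (A v) ⇔-∘ (≡-⇔ˡ (cond u v) ⇔-∘ common-parity u v)

proposition1 : ∀ {n : ℕ} (G : SimpleGraph n) (A : VSubset n) →
    ((P G A ⇔ Orthoprojection (addLoops G A)) ×
     (Orthoprojection (addLoops G A) ⇔ Idempotent (adjMatrix G +M diagMatrix A)))
proposition1 G A = a⇔b , b⇔c
  where
  loopsMatrix : ladj (addLoops G A) ≐ (adjMatrix G +M diagMatrix A)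
  loopsMatrix = addLoops-matrix G A

  b⇔c : Orthoprojection (addLoops G A) ⇔ Idempotent (adjMatrix G +M diagMatrix A)
  b⇔c = mk⇔ (idempotent-resp loopsMatrix) (idempotent-resp (λ i j → sym (loopsMatrix i j)))
          ⇔-∘ orthoprojection⇔idempotent (addLoops G A)

  a⇔b : P G A ⇔ Orthoprojection (addLoops G A)
  a⇔b = ⇔-sym b⇔c ⇔-∘ (⇔-sym (idempotent⇔parityCondition G A) ⇔-∘ P⇔parityCondition G A)
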